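{- For all integers $n\geq 1$, $ac(n)=f_3(n)+f_3(n-2)$.
   Context: A composition of $n$ of length $s$ is a sequence $\sigma=(\sigma_1,\ldots,\sigma_s)$ of positive integers with $\sum_i\sigma_i=n$; the empty composition is the unique composition of $0$. A composition is anti-palindromic if $\sigma_i\neq\sigma_{s-i+1}$ for all $i$ with $i\neq\frac{s+1}{2}$. $ac(n)$ denotes the number of anti-palindromic compositions of $n$. The tribonacci numbers are defined by $f_3(n)=0$ for $n<1$, $f_3(1)=1$, and $f_3(n)=f_3(n-1)+f_3(n-2)+f_3(n-3)$ for $n\geq 2$. -}

module Defs where

open import Data.Nat using (ℕ; zero; suc; _+_; _∸_)
open import Data.Nat.Properties using (_≟_)
open import Data.List using (List; []; _∷_; length; reverse; zip; filter; map; concat; upTo; allFin)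
open import Data.List.Relation.Unary.All using (All)
open import Data.List.Relation.Unary.All using (all?)
open import Data.Product using (_×_; _,_; proj₁; proj₂)
open import Data.Fin using (Fin; toℕ)
open import Relation.Binary.PropositionalEquality using (_≡_; _≢_)
open import Relation.Nullary using (Dec; ¬_; yes; no)
open import Relation.Nullary.Decidable using (¬?; _⊎-dec_)
open import Data.Sum using (_⊎_)

-- A composition is a list of positive integers; here we enumerate all
-- compositions of n (lists of positive naturals with sum n).
-- compositionsFrom fuel n : all compositions of n, where the first part
-- k ranges over 1..n (fuel = n structurally bounds the recursion).
compsAux : ℕ → ℕ → List (List ℕ)
compsAux zero    zero    = [] ∷ []
compsAux zero    (suc _) = []
compsAux (suc f) zero    = [] ∷ []
compsAux (suc f) (suc n) =
  concat (map (λ k → map (λ c → suc k ∷ c) (compsAux f (n ∸ k))) (upTo (suc n)))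

compositions : ℕ → List (List ℕ)
compositions n = compsAux n n

-- The positions i (0-based) of a list σ of length s; index i is paired with
-- position s-1-i. Anti-palindromic: for every i with i ≠ s-1-i
-- (i.e. i ≠ (s+1)/2 in 1-based indexing), σ_i ≠ σ_{s-1-i}.
-- Pairing σ with its reverse gives exactly the pairs (σ_i, σ_{s-1-i}).
-- A middle element (odd s) is paired with itself; we exempt it by its index.
indexed : {A : Set} → ℕ → List A → List (ℕ × A)
indexed i []       = []
indexed i (x ∷ xs) = (i , x) ∷ indexed (suc i) xs

AntiPalindromic : List ℕ → Set
AntiPalindromic σ =
  All (λ p → (proj₁ p + proj₁ p + 1 ≡ length σ) ⊎ (proj₁ (proj₂ p) ≢ proj₂ (proj₂ p)))
      (indexed 0 (zip σ (reverse σ)))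

antiPalindromic? : (σ : List ℕ) → Dec (AntiPalindromic σ)
antiPalindromic? σ =
  all? (λ p → ((proj₁ p + proj₁ p + 1) ≟ length σ) ⊎-dec ¬? (proj₁ (proj₂ p) ≟ proj₂ (proj₂ p)))
       (indexed 0 (zip σ (reverse σ)))

ac : ℕ → ℕ
ac n = length (filter antiPalindromic? (compositions n))

-- tribonacci: f₃ 0 = 0, f₃ 1 = 1, f₃ 2 = f₃ 1 + f₃ 0 + f₃(-1) = 1,
-- f₃ (n+3) = f₃ (n+2) + f₃ (n+1) + f₃ n
f₃ : ℕ → ℕ
f₃ zero = 0
f₃ (suc zero) = 1
f₃ (suc (suc zero)) = 1
f₃ (suc (suc (suc n))) = f₃ (suc (suc n)) + f₃ (suc n) + f₃ n

-- Write ac n as the sum of the indicator χAP of anti-palindromy over the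
-- compositions of n.  Classify a composition of n + 2 (n ≥ 1) by whether its
-- first and last parts equal 1.  If both do, it is not anti-palindromic.  If
-- only the first does, it is 1 ∷ ρ ∷ʳ (ℓ + 1) with ρ ∷ʳ ℓ a composition of n,
-- and it is anti-palindromic iff ρ is; these contribute Σ_{k<n} ac k, and so do
-- those whose last part only is 1.  If neither does, decrementing both end
-- parts preserves anti-palindromy and leaves a composition of n.  Hence
-- ac (n + 2) = 2 Σ_{k<n} ac k + ac n, which yields the tribonacci recurrence
-- ac (n + 3) = ac (n + 2) + ac (n + 1) + ac n for n ≥ 1.  The sequence
-- f₃ n + f₃ (n - 2) satisfies the same recurrence and initial values 1, 1, 3.

module Submission where

open import Defs
open import Data.Bool using (true; false; if_then_else_)
open import Data.List
  using ( List; []; _∷_; _++_; _∷ʳ_; length; reverse; zip; filter; map; concat; applyUpTo; upTo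
        ; drop; initLast; _∷ʳ′_)
open import Data.List.Properties
  using (map-cong; map-∘; map-++; length-++; length-reverse; unfold-reverse; reverse-++)
open import Data.List.Relation.Unary.All as All using (All; []; _∷_)
import Data.List.Relation.Unary.All.Properties as All
open import Data.Nat.ListAction using (sum)
open import Data.Nat.ListAction.Properties using (sum-++)
open import Data.Nat using (ℕ; zero; suc; _+_; _∸_; _≥_; _<_; _≤_; z≤n; s≤s)
open import Data.Nat.Properties
  using (_≟_; +-assoc; +-comm; +-suc; +-identityʳ; suc-injective; ≤-refl; ≤-trans; m∸n≤m)
open import Data.Nat.Solver using (module +-*-Solver)
open import Data.Product using (_×_; _,_; proj₁; proj₂; map₁)
open import Data.Sum using (_⊎_; inj₁; inj₂)
open import Function using (_∘_; _⇔_; mk⇔; Equivalence)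
open import Relation.Binary.PropositionalEquality
open import Relation.Nullary using (yes; no; ¬_; does)
open import Relation.Nullary.Decidable using (dec-false; does-⇔)
open import Relation.Unary using (Decidable)

open +-*-Solver
open ≡-Reasoning

private
  variable
    A B : Set

Weight : Set
Weight = List ℕ → ℕ

Positive : List ℕ → Set
Positive = All (0 <_)

onNonEmpty : (List ℕ → List ℕ) → Weight → Weight
onNonEmpty f w []       = 0
onNonEmpty f w (x ∷ xs) = w (f (x ∷ xs))

incHead : List ℕ → List ℕ
incHead []       = []
incHead (x ∷ xs) = suc x ∷ xs

incLast : List ℕ → List ℕ
incLast []           = []
incLast (x ∷ [])     = suc x ∷ []
incLast (x ∷ y ∷ xs) = x ∷ incLast (y ∷ xs)

dropLast : List ℕ → List ℕ
dropLast []           = []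
dropLast (x ∷ [])     = []
dropLast (x ∷ y ∷ xs) = x ∷ dropLast (y ∷ xs)

incLast-∷ʳ : ∀ xs x → incLast (xs ∷ʳ x) ≡ xs ∷ʳ suc x
incLast-∷ʳ []           x = refl
incLast-∷ʳ (y ∷ [])     x = refl
incLast-∷ʳ (y ∷ z ∷ ys) x = cong (y ∷_) (incLast-∷ʳ (z ∷ ys) x)

dropLast-∷ʳ : ∀ xs x → dropLast (xs ∷ʳ x) ≡ xs
dropLast-∷ʳ []           x = refl
dropLast-∷ʳ (y ∷ [])     x = refl
dropLast-∷ʳ (y ∷ z ∷ ys) x = cong (y ∷_) (dropLast-∷ʳ (z ∷ ys) x)

dropLast-incLast : ∀ xs → dropLast (incLast xs) ≡ dropLast xs
dropLast-incLast []           = refl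
dropLast-incLast (x ∷ [])     = refl
dropLast-incLast (x ∷ y ∷ []) = refl
dropLast-incLast (x ∷ y ∷ z ∷ xs) = cong (x ∷_) (dropLast-incLast (y ∷ z ∷ xs))

onNonEmpty-∷ʳ : ∀ f w xs x → onNonEmpty f w (xs ∷ʳ x) ≡ w (f (xs ∷ʳ x))
onNonEmpty-∷ʳ f w []       x = refl
onNonEmpty-∷ʳ f w (_ ∷ _) x = refl

-- sumComps w n is the sum of w over the compositions of n: those of n + 1
-- arise from the compositions of n by prepending a part 1 or by incrementing
-- the first part (which the empty composition lacks, hence onNonEmpty).
sumComps : Weight → ℕ → ℕ
sumComps w zero    = w []
sumComps w (suc n) = sumComps (w ∘ (1 ∷_)) n + sumComps (onNonEmpty incHead w) n

mutual
  sumComps-cong : ∀ n {w v : Weight} → (∀ τ → Positive τ → w τ ≡ v τ) →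
                  sumComps w n ≡ sumComps v n
  sumComps-cong zero    w≗v = w≗v [] []
  sumComps-cong (suc n) w≗v = sumComps-cong⁺ n (λ x xs → w≗v (x ∷ xs))

  sumComps-cong⁺ : ∀ n {w v : Weight} →
                   (∀ x xs → Positive (x ∷ xs) → w (x ∷ xs) ≡ v (x ∷ xs)) →
                   sumComps w (suc n) ≡ sumComps v (suc n)
  sumComps-cong⁺ n {w} {v} w≗v =
    cong₂ _+_ (sumComps-cong n (λ τ p → w≗v 1 τ (s≤s z≤n ∷ p)))
              (sumComps-cong n incHead-cong)
    where
    incHead-cong : ∀ τ → Positive τ → onNonEmpty incHead w τ ≡ onNonEmpty incHead v τ
    incHead-cong []       _        = refl
    incHead-cong (x ∷ xs) (_ ∷ p) = w≗v (suc x) xs (s≤s z≤n ∷ p)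

sumComps-zero : ∀ n → sumComps (λ _ → 0) n ≡ 0
sumComps-zero zero    = refl
sumComps-zero (suc n) =
  cong₂ _+_ (sumComps-zero n)
            (trans (sumComps-cong n λ { [] _ → refl ; (_ ∷ _) _ → refl }) (sumComps-zero n))

sumComps-+ : ∀ n (w v : Weight) →
             sumComps (λ τ → w τ + v τ) n ≡ sumComps w n + sumComps v n
sumComps-+ zero    w v = refl
sumComps-+ (suc n) w v = begin
  sumComps (λ τ → w (1 ∷ τ) + v (1 ∷ τ)) n + sumComps (onNonEmpty incHead (λ τ → w τ + v τ)) n
    ≡⟨ cong₂ _+_ (sumComps-+ n _ _)
                 (trans (sumComps-cong n λ { [] _ → refl ; (_ ∷ _) _ → refl }) (sumComps-+ n _ _)) ⟩
  (sumComps (w ∘ (1 ∷_)) n + sumComps (v ∘ (1 ∷_)) n)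
    + (sumComps (onNonEmpty incHead w) n + sumComps (onNonEmpty incHead v) n)
    ≡⟨ interchange (sumComps (w ∘ (1 ∷_)) n) _ (sumComps (onNonEmpty incHead w) n) _ ⟩
  sumComps w (suc n) + sumComps v (suc n) ∎
  where
  interchange : ∀ a b c d → (a + b) + (c + d) ≡ (a + c) + (b + d)
  interchange = solve 4 (λ a b c d → (a :+ b) :+ (c :+ d) := (a :+ c) :+ (b :+ d)) refl

sumComps-∷ʳ : ∀ n (w : Weight) →
              sumComps w (suc n) ≡ sumComps (w ∘ (_∷ʳ 1)) n + sumComps (onNonEmpty incLast w) n
sumComps-∷ʳ zero    w = refl
sumComps-∷ʳ (suc n) w = begin
  sumComps (w ∘ (1 ∷_)) (suc n) + sumComps (onNonEmpty incHead w) (suc n)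
    ≡⟨ cong₂ _+_ (sumComps-∷ʳ n _) (sumComps-∷ʳ n _) ⟩
  (a + b) + (c + d)
    ≡⟨ regroup a b c d ⟩
  (a + (b + c)) + d
    ≡⟨ cong₂ (λ m k → (a + m) + k) mixed (sumComps-cong n incHead-incLast) ⟩
  (a + (b′ + c′)) + d′
    ≡⟨ regroup a b′ c′ d′ ⟨
  sumComps (w ∘ (_∷ʳ 1)) (suc n) + sumComps (onNonEmpty incLast w) (suc n) ∎
  where
  a b c d b′ c′ d′ : ℕ
  a  = sumComps (λ τ → w (1 ∷ (τ ∷ʳ 1))) n
  b  = sumComps (onNonEmpty incLast (w ∘ (1 ∷_))) n
  c  = sumComps (onNonEmpty incHead w ∘ (_∷ʳ 1)) n
  d  = sumComps (onNonEmpty incLast (onNonEmpty incHead w)) n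
  b′ = sumComps (onNonEmpty incHead (w ∘ (_∷ʳ 1))) n
  c′ = sumComps (onNonEmpty incLast w ∘ (1 ∷_)) n
  d′ = sumComps (onNonEmpty incHead (onNonEmpty incLast w)) n

  regroup : ∀ a b c d → (a + b) + (c + d) ≡ (a + (b + c)) + d
  regroup = solve 4 (λ a b c d → (a :+ b) :+ (c :+ d) := (a :+ (b :+ c)) :+ d) refl

  -- The mixed terms match crosswise except on the empty list, so only their sums agree.
  swapped : ∀ τ → Positive τ →
            onNonEmpty incLast (w ∘ (1 ∷_)) τ + onNonEmpty incHead w (τ ∷ʳ 1)
              ≡ onNonEmpty incHead (w ∘ (_∷ʳ 1)) τ + onNonEmpty incLast w (1 ∷ τ)
  swapped []       _ = refl
  swapped (x ∷ xs) _ = +-comm (w (1 ∷ incLast (x ∷ xs))) _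

  mixed : b + c ≡ b′ + c′
  mixed = trans (sym (sumComps-+ n _ _)) (trans (sumComps-cong n swapped) (sumComps-+ n _ _))

  incHead-incLast : ∀ τ → Positive τ →
                    onNonEmpty incLast (onNonEmpty incHead w) τ
                      ≡ onNonEmpty incHead (onNonEmpty incLast w) τ
  incHead-incLast []           _ = refl
  incHead-incLast (x ∷ [])     _ = refl
  incHead-incLast (x ∷ y ∷ xs) _ = refl

sumComps-ends : ∀ n (w : Weight) →
  sumComps w (2 + n)
    ≡ (sumComps (λ τ → w (1 ∷ (τ ∷ʳ 1))) n + sumComps (onNonEmpty incLast (w ∘ (1 ∷_))) n)
      + (sumComps (onNonEmpty incHead w ∘ (_∷ʳ 1)) n
         + sumComps (onNonEmpty incLast (onNonEmpty incHead w)) n)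
sumComps-ends n w = cong₂ _+_ (sumComps-∷ʳ n _) (sumComps-∷ʳ n _)

sumBelow : (ℕ → ℕ) → ℕ → ℕ
sumBelow g zero    = 0
sumBelow g (suc n) = g 0 + sumBelow (g ∘ suc) n

sumBelow-suc : ∀ g n → sumBelow g (suc n) ≡ sumBelow g n + g n
sumBelow-suc g zero    = +-identityʳ (g 0)
sumBelow-suc g (suc n) =
  trans (cong (g 0 +_) (sumBelow-suc (g ∘ suc) n)) (sym (+-assoc (g 0) _ _))

sumComps-onTail : ∀ n (w : Weight) → sumComps (onNonEmpty (drop 1) w) n ≡ sumBelow (sumComps w) n
sumComps-onTail zero    w = refl
sumComps-onTail (suc n) w = begin
  sumComps w n + sumComps (onNonEmpty incHead (onNonEmpty (drop 1) w)) n
    ≡⟨ cong (sumComps w n +_)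
            (trans (sumComps-cong n λ { [] _ → refl ; (_ ∷ _) _ → refl }) (sumComps-onTail n w)) ⟩
  sumComps w n + sumBelow (sumComps w) n
    ≡⟨ +-comm (sumComps w n) _ ⟩
  sumBelow (sumComps w) n + sumComps w n
    ≡⟨ sumBelow-suc (sumComps w) n ⟨
  sumBelow (sumComps w) (suc n) ∎

sumComps-onInit : ∀ n (w : Weight) → sumComps (onNonEmpty dropLast w) n ≡ sumBelow (sumComps w) n
sumComps-onInit zero    w = refl
sumComps-onInit (suc n) w = begin
  sumComps (onNonEmpty dropLast w) (suc n)
    ≡⟨ sumComps-∷ʳ n _ ⟩
  sumComps (onNonEmpty dropLast w ∘ (_∷ʳ 1)) n
    + sumComps (onNonEmpty incLast (onNonEmpty dropLast w)) n
    ≡⟨ cong₂ _+_ (sumComps-cong n dropLast-snoc)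
                 (trans (sumComps-cong n dropLast-inc) (sumComps-onInit n w)) ⟩
  sumComps w n + sumBelow (sumComps w) n
    ≡⟨ +-comm (sumComps w n) _ ⟩
  sumBelow (sumComps w) n + sumComps w n
    ≡⟨ sumBelow-suc (sumComps w) n ⟨
  sumBelow (sumComps w) (suc n) ∎
  where
  dropLast-snoc : ∀ τ → Positive τ → onNonEmpty dropLast w (τ ∷ʳ 1) ≡ w τ
  dropLast-snoc τ _ = trans (onNonEmpty-∷ʳ dropLast w τ 1) (cong w (dropLast-∷ʳ τ 1))

  dropLast-inc : ∀ τ → Positive τ →
                 onNonEmpty incLast (onNonEmpty dropLast w) τ ≡ onNonEmpty dropLast w τ
  dropLast-inc []           _ = refl
  dropLast-inc (x ∷ [])     _ = refl
  dropLast-inc (x ∷ y ∷ xs) _ = cong w (dropLast-incLast (x ∷ y ∷ xs))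

sum-map-concatMap : ∀ (w : B → ℕ) (G : A → List B) xs →
                    sum (map w (concat (map G xs))) ≡ sum (map (λ x → sum (map w (G x))) xs)
sum-map-concatMap w G []       = refl
sum-map-concatMap w G (x ∷ xs) = begin
  sum (map w (G x ++ concat (map G xs)))
    ≡⟨ cong sum (map-++ w (G x) _) ⟩
  sum (map w (G x) ++ map w (concat (map G xs)))
    ≡⟨ sum-++ (map w (G x)) _ ⟩
  sum (map w (G x)) + sum (map w (concat (map G xs)))
    ≡⟨ cong (sum (map w (G x)) +_) (sum-map-concatMap w G xs) ⟩
  sum (map (λ x → sum (map w (G x))) (x ∷ xs)) ∎

sum-map-applyUpTo : ∀ (g f : ℕ → ℕ) n → sum (map g (applyUpTo f n)) ≡ sumBelow (g ∘ f) n
sum-map-applyUpTo g f zero    = refl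
sum-map-applyUpTo g f (suc n) = cong (g (f 0) +_) (sum-map-applyUpTo g (f ∘ suc) n)

sumComps-byFirstPart : ∀ n (w : Weight) →
                       sumBelow (λ k → sumComps (w ∘ (suc k ∷_)) (n ∸ k)) (suc n) ≡ sumComps w (suc n)
sumComps-byFirstPart zero    w = refl
sumComps-byFirstPart (suc n) w =
  cong (sumComps (w ∘ (1 ∷_)) (suc n) +_) (sumComps-byFirstPart n (onNonEmpty incHead w))

sum-map-compsAux : ∀ f n → n ≤ f → (w : Weight) → sum (map w (compsAux f n)) ≡ sumComps w n
sum-map-compsAux zero    zero    _         w = +-identityʳ (w [])
sum-map-compsAux (suc f) zero    _         w = +-identityʳ (w [])
sum-map-compsAux (suc f) (suc n) (s≤s n≤f) w = begin
  sum (map w (concat (map G (upTo (suc n)))))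
    ≡⟨ sum-map-concatMap w G (upTo (suc n)) ⟩
  sum (map (λ k → sum (map w (G k))) (upTo (suc n)))
    ≡⟨ cong sum (map-cong byFirstPart (upTo (suc n))) ⟩
  sum (map (λ k → sumComps (w ∘ (suc k ∷_)) (n ∸ k)) (upTo (suc n)))
    ≡⟨ sum-map-applyUpTo _ (λ k → k) (suc n) ⟩
  sumBelow (λ k → sumComps (w ∘ (suc k ∷_)) (n ∸ k)) (suc n)
    ≡⟨ sumComps-byFirstPart n w ⟩
  sumComps w (suc n) ∎
  where
  G : ℕ → List (List ℕ)
  G k = map (suc k ∷_) (compsAux f (n ∸ k))

  byFirstPart : ∀ k → sum (map w (G k)) ≡ sumComps (w ∘ (suc k ∷_)) (n ∸ k)
  byFirstPart k = trans (cong sum (sym (map-∘ (compsAux f (n ∸ k)))))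
                        (sum-map-compsAux f (n ∸ k) (≤-trans (m∸n≤m n k) n≤f) (w ∘ (suc k ∷_)))

indicator : {P : A → Set} → Decidable P → A → ℕ
indicator P? x = if does (P? x) then 1 else 0

length-filter≡sum-indicator : ∀ {P : A → Set} (P? : Decidable P) xs →
                              length (filter P? xs) ≡ sum (map (indicator P?) xs)
length-filter≡sum-indicator P? []       = refl
length-filter≡sum-indicator P? (x ∷ xs) with does (P? x)
... | true  = cong suc (length-filter≡sum-indicator P? xs)
... | false = length-filter≡sum-indicator P? xs

indicator-false : ∀ {P : A → Set} (P? : Decidable P) {x} → ¬ P x → indicator P? x ≡ 0
indicator-false P? {x} ¬px = cong (λ b → if b then 1 else 0) (dec-false (P? x) ¬px)

indicator-⇔ : ∀ {P : A → Set} (P? : Decidable P) {x y} → P x ⇔ P y →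
              indicator P? x ≡ indicator P? y
indicator-⇔ P? {x} {y} px⇔py = cong (λ b → if b then 1 else 0) (does-⇔ px⇔py (P? x) (P? y))

χAP : Weight
χAP = indicator antiPalindromic?

ac≡sumComps-χAP : ∀ n → ac n ≡ sumComps χAP n
ac≡sumComps-χAP n = trans (length-filter≡sum-indicator antiPalindromic? (compositions n))
                          (sum-map-compsAux n n ≤-refl χAP)

mirrorPairs : List ℕ → List (ℕ × ℕ × ℕ)
mirrorPairs σ = indexed 0 (zip σ (reverse σ))

CentreOrDistinct : ℕ → ℕ × ℕ × ℕ → Set
CentreOrDistinct s (i , x , y) = (i + i + 1 ≡ s) ⊎ (x ≢ y)

zip-∷ʳ : ∀ (xs : List A) (ys : List B) x y → length xs ≡ length ys →
         zip (xs ∷ʳ x) (ys ∷ʳ y) ≡ zip xs ys ∷ʳ (x , y)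
zip-∷ʳ []       []       x y _ = refl
zip-∷ʳ (x′ ∷ xs) (y′ ∷ ys) x y e = cong ((x′ , y′) ∷_) (zip-∷ʳ xs ys x y (suc-injective e))

indexed-∷ʳ : ∀ i (xs : List A) x → indexed i (xs ∷ʳ x) ≡ indexed i xs ∷ʳ (i + length xs , x)
indexed-∷ʳ i []       x = cong (λ j → (j , x) ∷ []) (sym (+-identityʳ i))
indexed-∷ʳ i (y ∷ xs) x =
  cong ((i , y) ∷_) (trans (indexed-∷ʳ (suc i) xs x)
                           (cong (λ j → indexed (suc i) xs ∷ʳ (j , x)) (sym (+-suc i (length xs)))))

indexed-suc : ∀ i (xs : List A) → indexed (suc i) xs ≡ map (map₁ suc) (indexed i xs)
indexed-suc i []       = refl
indexed-suc i (x ∷ xs) = cong ((suc i , x) ∷_) (indexed-suc (suc i) xs)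

reverse-∷-∷ʳ : ∀ (a : A) ys b → reverse (a ∷ (ys ∷ʳ b)) ≡ b ∷ (reverse ys ∷ʳ a)
reverse-∷-∷ʳ a ys b = trans (unfold-reverse a (ys ∷ʳ b)) (cong (_∷ʳ a) (reverse-++ ys (b ∷ [])))

mirrorPairs-∷-∷ʳ : ∀ a ys b →
  mirrorPairs (a ∷ (ys ∷ʳ b))
    ≡ (0 , a , b) ∷ (map (map₁ suc) (mirrorPairs ys) ∷ʳ (suc (length (zip ys (reverse ys))) , b , a))
mirrorPairs-∷-∷ʳ a ys b
  rewrite reverse-∷-∷ʳ a ys b
        | zip-∷ʳ ys (reverse ys) b a (sym (length-reverse ys))
        | indexed-∷ʳ 1 (zip ys (reverse ys)) (b , a)
        | indexed-suc 0 (zip ys (reverse ys)) = refl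

length-∷-∷ʳ : ∀ (a : A) ys b → length (a ∷ (ys ∷ʳ b)) ≡ 2 + length ys
length-∷-∷ʳ a ys b = cong suc (trans (length-++ ys) (+-comm (length ys) 1))

CentreOrDistinct-suc : ∀ s p → CentreOrDistinct (2 + s) (map₁ suc p) ⇔ CentreOrDistinct s p
CentreOrDistinct-suc s (i , x , y) = mk⇔ to from
  where
  centre-suc : suc i + suc i + 1 ≡ 2 + (i + i + 1)
  centre-suc = cong (λ m → suc (m + 1)) (+-suc i i)

  to : CentreOrDistinct (2 + s) (suc i , x , y) → CentreOrDistinct s (i , x , y)
  to (inj₁ e)  = inj₁ (suc-injective (suc-injective (trans (sym centre-suc) e)))
  to (inj₂ x≢y) = inj₂ x≢y

  from : CentreOrDistinct s (i , x , y) → CentreOrDistinct (2 + s) (suc i , x , y)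
  from (inj₁ e)  = inj₁ (trans centre-suc (cong (2 +_) e))
  from (inj₂ x≢y) = inj₂ x≢y

All-CentreOrDistinct-wrap : ∀ s a b j ps →
  All (CentreOrDistinct (2 + s)) ((0 , a , b) ∷ (map (map₁ suc) ps ∷ʳ (j , b , a)))
    ⇔ (a ≢ b × All (CentreOrDistinct s) ps)
All-CentreOrDistinct-wrap s a b j ps = mk⇔ to from
  where
  to : All (CentreOrDistinct (2 + s)) ((0 , a , b) ∷ (map (map₁ suc) ps ∷ʳ (j , b , a))) →
       a ≢ b × All (CentreOrDistinct s) ps
  to (inj₁ () ∷ _)
  to (inj₂ a≢b ∷ rest) =
    a≢b , All.map (Equivalence.to (CentreOrDistinct-suc s _)) (All.map⁻ (proj₁ (All.∷ʳ⁻ rest)))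

  from : a ≢ b × All (CentreOrDistinct s) ps →
         All (CentreOrDistinct (2 + s)) ((0 , a , b) ∷ (map (map₁ suc) ps ∷ʳ (j , b , a)))
  from (a≢b , ps-ok) =
    inj₂ a≢b ∷ All.∷ʳ⁺ (All.map⁺ (All.map (Equivalence.from (CentreOrDistinct-suc s _)) ps-ok))
                       (inj₂ (a≢b ∘ sym))

antiPalindromic-∷-∷ʳ : ∀ a ys b → AntiPalindromic (a ∷ (ys ∷ʳ b)) ⇔ (a ≢ b × AntiPalindromic ys)
antiPalindromic-∷-∷ʳ a ys b
  rewrite length-∷-∷ʳ a ys b | mirrorPairs-∷-∷ʳ a ys b =
  All-CentreOrDistinct-wrap (length ys) a b _ (mirrorPairs ys)

χAP-equalEnds : ∀ a ys → χAP (a ∷ (ys ∷ʳ a)) ≡ 0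
χAP-equalEnds a ys =
  indicator-false antiPalindromic? (λ ap → proj₁ (Equivalence.to (antiPalindromic-∷-∷ʳ a ys a) ap) refl)

χAP-distinctEnds : ∀ {a b} ys → a ≢ b → χAP (a ∷ (ys ∷ʳ b)) ≡ χAP ys
χAP-distinctEnds {a} {b} ys a≢b = indicator-⇔ antiPalindromic?
  (mk⇔ (proj₂ ∘ Equivalence.to (antiPalindromic-∷-∷ʳ a ys b))
       (λ ap → Equivalence.from (antiPalindromic-∷-∷ʳ a ys b) (a≢b , ap)))

χAP-incEnds : ∀ a ys b → χAP (suc a ∷ (ys ∷ʳ suc b)) ≡ χAP (a ∷ (ys ∷ʳ b))
χAP-incEnds a ys b with a ≟ b
... | yes refl = trans (χAP-equalEnds (suc a) ys) (sym (χAP-equalEnds a ys))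
... | no a≢b  = trans (χAP-distinctEnds ys (a≢b ∘ suc-injective)) (sym (χAP-distinctEnds ys a≢b))

firstPartOne : ∀ τ → Positive τ → onNonEmpty incLast (χAP ∘ (1 ∷_)) τ ≡ onNonEmpty dropLast χAP τ
firstPartOne τ τ>0 with initLast τ
... | []       = refl
... | ys ∷ʳ′ y = begin
  onNonEmpty incLast (χAP ∘ (1 ∷_)) (ys ∷ʳ y) ≡⟨ onNonEmpty-∷ʳ incLast _ ys y ⟩
  χAP (1 ∷ incLast (ys ∷ʳ y))                 ≡⟨ cong (χAP ∘ (1 ∷_)) (incLast-∷ʳ ys y) ⟩
  χAP (1 ∷ (ys ∷ʳ suc y))                     ≡⟨ χAP-distinctEnds ys (1≢suc (proj₂ (All.∷ʳ⁻ τ>0))) ⟩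
  χAP ys                                      ≡⟨ cong χAP (dropLast-∷ʳ ys y) ⟨
  χAP (dropLast (ys ∷ʳ y))                    ≡⟨ onNonEmpty-∷ʳ dropLast χAP ys y ⟨
  onNonEmpty dropLast χAP (ys ∷ʳ y) ∎
  where
  1≢suc : ∀ {y} → 0 < y → 1 ≢ suc y
  1≢suc (s≤s z≤n) ()

lastPartOne : ∀ x xs → Positive (x ∷ xs) →
              onNonEmpty incHead χAP ((x ∷ xs) ∷ʳ 1) ≡ onNonEmpty (drop 1) χAP (x ∷ xs)
lastPartOne _ xs (s≤s z≤n ∷ _) = χAP-distinctEnds xs λ ()

noPartOne : ∀ x xs → Positive (x ∷ xs) →
            onNonEmpty incLast (onNonEmpty incHead χAP) (x ∷ xs) ≡ χAP (x ∷ xs)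
noPartOne x xs _ with initLast xs
... | []       = refl
... | ys ∷ʳ′ y = trans (cong (onNonEmpty incHead χAP) (incLast-∷ʳ (x ∷ ys) y)) (χAP-incEnds x ys y)

sumComps-χAP-recurrence : ∀ n →
  sumComps χAP (3 + n)
    ≡ sumBelow (sumComps χAP) (suc n) + sumBelow (sumComps χAP) (suc n) + sumComps χAP (suc n)
sumComps-χAP-recurrence n = begin
  sumComps χAP (3 + n)
    ≡⟨ sumComps-ends (suc n) χAP ⟩
  (sumComps (λ τ → χAP (1 ∷ (τ ∷ʳ 1))) (suc n) + sumComps (onNonEmpty incLast (χAP ∘ (1 ∷_))) (suc n))
    + (sumComps (onNonEmpty incHead χAP ∘ (_∷ʳ 1)) (suc n)
       + sumComps (onNonEmpty incLast (onNonEmpty incHead χAP)) (suc n))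
    ≡⟨ cong₂ _+_ (cong₂ _+_ bothOne firstOne) (cong₂ _+_ lastOne noOne) ⟩
  (0 + S) + (S + sumComps χAP (suc n))
    ≡⟨ +-assoc S S _ ⟨
  S + S + sumComps χAP (suc n) ∎
  where
  S : ℕ
  S = sumBelow (sumComps χAP) (suc n)

  bothOne : sumComps (λ τ → χAP (1 ∷ (τ ∷ʳ 1))) (suc n) ≡ 0
  bothOne = trans (sumComps-cong (suc n) (λ τ _ → χAP-equalEnds 1 τ)) (sumComps-zero (suc n))

  firstOne : sumComps (onNonEmpty incLast (χAP ∘ (1 ∷_))) (suc n) ≡ S
  firstOne = trans (sumComps-cong (suc n) firstPartOne) (sumComps-onInit (suc n) χAP)

  lastOne : sumComps (onNonEmpty incHead χAP ∘ (_∷ʳ 1)) (suc n) ≡ S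
  lastOne = trans (sumComps-cong⁺ n lastPartOne) (sumComps-onTail (suc n) χAP)

  noOne : sumComps (onNonEmpty incLast (onNonEmpty incHead χAP)) (suc n) ≡ sumComps χAP (suc n)
  noOne = sumComps-cong⁺ n noPartOne

TribonacciRecurrent : (ℕ → ℕ) → Set
TribonacciRecurrent a = ∀ n → a (3 + n) ≡ a (2 + n) + a (1 + n) + a n

tribonacciRecurrent-unique : ∀ a b → TribonacciRecurrent a → TribonacciRecurrent b →
                             a 0 ≡ b 0 → a 1 ≡ b 1 → a 2 ≡ b 2 → ∀ n → a n ≡ b n
tribonacciRecurrent-unique a b rec-a rec-b e₀ e₁ e₂ n = proj₁ (agree n)
  where
  agree : ∀ n → a n ≡ b n × a (1 + n) ≡ b (1 + n) × a (2 + n) ≡ b (2 + n)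
  agree zero    = e₀ , e₁ , e₂
  agree (suc n) with agree n
  ... | eₙ , eₙ₊₁ , eₙ₊₂ =
    eₙ₊₁ , eₙ₊₂ , trans (rec-a n) (trans (cong₂ _+_ (cong₂ _+_ eₙ₊₂ eₙ₊₁) eₙ) (sym (rec-b n)))

sumComps-χAP-tribonacci : TribonacciRecurrent (sumComps χAP ∘ suc)
sumComps-χAP-tribonacci n = begin
  K (4 + n)
    ≡⟨ sumComps-χAP-recurrence (suc n) ⟩
  S (2 + n) + S (2 + n) + K (2 + n)
    ≡⟨ cong (λ s → s + s + K (2 + n)) (sumBelow-suc K (suc n)) ⟩
  (S (1 + n) + K (1 + n)) + (S (1 + n) + K (1 + n)) + K (2 + n)
    ≡⟨ regroup (S (1 + n)) (K (1 + n)) (K (2 + n)) ⟩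
  (S (1 + n) + S (1 + n) + K (1 + n)) + K (2 + n) + K (1 + n)
    ≡⟨ cong (λ k → k + K (2 + n) + K (1 + n)) (sumComps-χAP-recurrence n) ⟨
  K (3 + n) + K (2 + n) + K (1 + n) ∎
  where
  K S : ℕ → ℕ
  K = sumComps χAP
  S = sumBelow K

  regroup : ∀ s k₁ k₂ → (s + k₁) + (s + k₁) + k₂ ≡ (s + s + k₁) + k₂ + k₁
  regroup = solve 3 (λ s k₁ k₂ → (s :+ k₁) :+ (s :+ k₁) :+ k₂ := (s :+ s :+ k₁) :+ k₂ :+ k₁) refl

-- f₃ (-1) = 0 lets the recurrence reach down to index 2.
f₃-suc-suc : ∀ n → f₃ (2 + n) ≡ f₃ (1 + n) + f₃ n + f₃ (n ∸ 1)
f₃-suc-suc zero    = refl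
f₃-suc-suc (suc n) = refl

f₃-tribonacci : TribonacciRecurrent (λ n → f₃ (suc n) + f₃ (n ∸ 1))
f₃-tribonacci n =
  trans (cong (λ t → f₃ (3 + n) + f₃ (2 + n) + f₃ (1 + n) + t) (f₃-suc-suc n))
        (regroup (f₃ (3 + n)) (f₃ (2 + n)) (f₃ (1 + n)) (f₃ n) (f₃ (n ∸ 1)))
  where
  regroup : ∀ a b c d e → a + b + c + (c + d + e) ≡ a + c + (b + d) + (c + e)
  regroup = solve 5 (λ a b c d e → a :+ b :+ c :+ (c :+ d :+ e) := a :+ c :+ (b :+ d) :+ (c :+ e)) refl

theorem2 : (n : ℕ) → n ≥ 1 → ac n ≡ f₃ n + f₃ (n ∸ 2)
theorem2 (suc n) _ = begin
  ac (suc n)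
    ≡⟨ ac≡sumComps-χAP (suc n) ⟩
  sumComps χAP (suc n)
    ≡⟨ tribonacciRecurrent-unique (sumComps χAP ∘ suc) (λ m → f₃ (suc m) + f₃ (m ∸ 1))
                                  sumComps-χAP-tribonacci f₃-tribonacci refl refl refl n ⟩
  f₃ (suc n) + f₃ (n ∸ 1) ∎
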